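{- $D^s_f(Q_3;Q_1)=D_f(Q_3;Q_1)=3$, and for every $n\ge 4$, $D^s_f(Q_n;Q_1)=D_f(Q_n;Q_1)=n+1$.
   Context: The $n$-dimensional hypercube $Q_n$ is the graph whose vertices are the binary strings $x_1x_2\cdots x_n$ of length $n$, two vertices being adjacent iff they differ in exactly one position; $Q_1\cong K_2$. Distances are graph distances and the diameter of a graph is the maximum distance between two of its vertices. For a graph $G$ and a graph $W$, a $W$-structure in $G$ is a subgraph of $G$ isomorphic to $W$, and a $W$-substructure in $G$ is a subgraph of $G$ isomorphic to a connected subgraph of $W$. Removing a family of subgraphs from $G$ means deleting all of their vertices. The $W$-structure connectivity $\kappa(G;W)$ (resp. $W$-substructure connectivity $\kappa^s(G;W)$) is the minimum number $t$ such that there exist $t$ pairwise vertex-disjoint $W$-structures (resp. $W$-substructures) whose removal disconnects $G$. The $W$-structure fault diameter $D_f(G;W)$ (resp. $W$-substructure fault diameter $D^s_f(G;W)$) is the maximum diameter of a graph obtained from $G$ by removing at most $\kappa(G;W)-1$ pairwise vertex-disjoint $W$-structures (resp. at most $\kappa^s(G;W)-1$ pairwise vertex-disjoint $W$-substructures). -}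

module Defs where

open import Data.Bool using (Bool; true; false; _≟_)
open import Data.Nat using (ℕ; zero; suc; _+_; _≤_; _<_)
open import Data.Vec using (Vec; []; _∷_)
open import Data.List using (List; []; _∷_; length)
open import Data.List.Membership.Propositional using (_∈_)
open import Data.List.Relation.Unary.Any using (Any)
open import Data.List.Relation.Unary.AllPairs using (AllPairs)
open import Data.Product using (Σ; _×_; ∃; ∃-syntax)
open import Data.Empty using (⊥)
open import Relation.Nullary using (¬_; yes; no)
open import Relation.Binary.PropositionalEquality using (_≡_)

Vertex : ℕ → Set
Vertex n = Vec Bool n

hamming : ∀ {n} → Vertex n → Vertex n → ℕ
hamming []       []       = 0
hamming (x ∷ xs) (y ∷ ys) with x ≟ y
... | yes _ = hamming xs ys
... | no  _ = suc (hamming xs ys)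

Adj : ∀ {n} → Vertex n → Vertex n → Set
Adj u v = hamming u v ≡ 1

-- Q_1 ≅ K_2.  A subgraph of Q_n isomorphic to K_2 is given by two
-- adjacent vertices (and the edge between them).  The connected
-- subgraphs of K_2 are K_1 and K_2, so a Q_1-substructure is either a
-- single vertex or such an edge.  Removal only uses the vertex set.

data Q1Str (n : ℕ) : Set where
  edge : (u v : Vertex n) → Adj u v → Q1Str n

data Q1Sub (n : ℕ) : Set where
  vtx  : (u : Vertex n) → Q1Sub n
  edge : (u v : Vertex n) → Adj u v → Q1Sub n

strVerts : ∀ {n} → Q1Str n → List (Vertex n)
strVerts (edge u v _) = u ∷ v ∷ []

subVerts : ∀ {n} → Q1Sub n → List (Vertex n)
subVerts (vtx u)      = u ∷ []
subVerts (edge u v _) = u ∷ v ∷ []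

module _ {n : ℕ} {S : Set} (vs : S → List (Vertex n)) where

  VDisjoint : S → S → Set
  VDisjoint a b = ∀ x → x ∈ vs a → x ∈ vs b → ⊥

  PairwiseDisjoint : List S → Set
  PairwiseDisjoint F = AllPairs VDisjoint F

  Removed : List S → Vertex n → Set
  Removed F x = Any (λ s → x ∈ vs s) F

  Survives : List S → Vertex n → Set
  Survives F x = ¬ Removed F x

  data Walk (F : List S) : Vertex n → Vertex n → ℕ → Set where
    here : ∀ {u} → Survives F u → Walk F u u 0
    step : ∀ {u v w l} → Survives F u → Adj u v → Walk F v w l →
           Walk F u w (suc l)

  Disconnected : List S → Set
  Disconnected F = Σ (Vertex n) λ u → Σ (Vertex n) λ v →
    Survives F u × Survives F v × (∀ l → ¬ Walk F u v l)

  IsConnectivity : ℕ → Set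
  IsConnectivity k =
    (Σ (List S) λ F → length F ≡ k × PairwiseDisjoint F × Disconnected F)
    × (∀ F → PairwiseDisjoint F → Disconnected F → k ≤ length F)

  DiamAtMost : List S → ℕ → Set
  DiamAtMost F d = ∀ u v → Survives F u → Survives F v →
    Σ ℕ λ l → l ≤ d × Walk F u v l

  DiamIs : List S → ℕ → Set
  DiamIs F d = DiamAtMost F d ×
    (Σ (Vertex n) λ u → Σ (Vertex n) λ v →
       Survives F u × Survives F v × Walk F u v d ×
       (∀ l → Walk F u v l → d ≤ l))

  MaxFaultDiamIs : ℕ → ℕ → Set
  MaxFaultDiamIs k d =
    (∀ F → PairwiseDisjoint F → suc (length F) ≤ k → DiamAtMost F d)
    × (Σ (List S) λ F → PairwiseDisjoint F × suc (length F) ≤ k × DiamIs F d)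

  FaultDiameterIs : ℕ → Set
  FaultDiameterIs d =
    (Σ ℕ IsConnectivity) × (∀ k → IsConnectivity k → MaxFaultDiamIs k d)

StrFaultDiamIs : (n : ℕ) → ℕ → Set
StrFaultDiamIs n d = FaultDiameterIs (strVerts {n}) d

SubFaultDiamIs : (n : ℕ) → ℕ → Set
SubFaultDiamIs n d = FaultDiameterIs (subVerts {n}) d

{-# OPTIONS --safe #-}
module Submission where

-- A piece (a vertex or an edge) has diameter at most 1, so it contains at most
-- one vertex of any family of pairwise distant vertices; every count below is a
-- double count of this kind.
--
-- Upper bound. Let F consist of at most n − 2 pieces and let u, v survive, at
-- distance h. Walk greedily towards v. If u is blocked (all its neighbours in
-- the interval I(u,v) are removed), at least h pieces guard u. Giving every
-- other piece weight h, a weighted count over the n − h coordinates j where u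
-- and v agree finds one whose shifted interval I(uʲ,vʲ) is met only by guards,
-- by fewer than h of them and by no edge inside it; a geodesic there yields a
-- u–v walk of length h + 2 ≤ n + 1. Geodesics exist in an interval of dimension
-- k met by at most k − 1 pieces, at most k − 2 of them edges inside it: split
-- it along a coordinate fixed by one of these pieces and recurse into the half
-- avoiding it. Antipodal vertices are handled by this directly, and with a
-- single piece no vertex is blocked, which gives diameter n.
--
-- Lower bound. The n − 1 edges 0·w — 1·w over the neighbours w of 0ⁿ⁻¹ cut off
-- the edge 0·0ⁿ⁻¹ — 1·0ⁿ⁻¹. The n − 2 edges 00·w — 01·w over the neighbours w
-- of 0ⁿ⁻² force every walk from 00·0ⁿ⁻² to 01·1ⁿ⁻² to detour through x₀ = 1,
-- which a potential function charges in advance, so it has length at least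
-- n + 1. All families involved consist of edges, so structures and
-- substructures give the same numbers.

open import Defs
open import Data.Bool using (true; false; not; _≟_)
open import Data.Bool.Properties using (not-¬; ¬-not; not-injective)
open import Data.Empty using (⊥)
open import Data.Fin using (Fin; zero; suc)
import Data.Fin.Properties as Fin
open import Data.List as List using (List; []; _∷_; length)
open import Data.List.Membership.Propositional using (_∈_; _∉_; lose; find)
open import Data.List.Membership.Propositional.Properties using (∈-tabulate⁻; ∈-tabulate⁺)
open import Data.List.Properties using (length-map; length-tabulate)
open import Data.List.Relation.Unary.Any as Any using (Any; here; there)
open import Data.List.Relation.Unary.Any.Properties as Anyₚ using (lookup-index)
import Data.List.Relation.Unary.AllPairs as AllPairs
import Data.List.Relation.Unary.AllPairs.Properties as AllPairsₚ
open import Data.List.Relation.Unary.Unique.Propositional using (Unique)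
open import Data.List.Relation.Unary.Unique.Propositional.Properties using (tabulate⁺)
open import Data.Nat using (ℕ; zero; suc; _+_; _*_; _≤_; _<_; _<?_; z≤n; s≤s)
open import Data.Nat.Properties hiding (_≟_)
open import Data.Nat.Properties using () renaming (_≟_ to _≟ℕ_)
open import Algebra.Properties.Semiring.Sum +-*-semiring
  using (sum; sum-syntax; ∑-comm; ∑-distrib-+; sum-cong-≗; *-distribˡ-sum; *-distribʳ-sum)
open import Data.Nat.Tactic.RingSolver using (solve-∀)
open import Data.Product as Product using (Σ; ∃; _×_; _,_)
open import Data.Sum as Sum using (_⊎_; inj₁; inj₂)
open import Data.Unit using (⊤; tt)
open import Data.Vec using ([]; _∷_; _++_; lookup; updateAt; replicate)
import Data.Vec.Properties as Vec
open import Data.Vec.Properties using (lookup∘updateAt; lookup∘updateAt′; ++-injectiveʳ)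
open import Function using (_∘_)
open import Level using (Level)
open import Relation.Binary.PropositionalEquality
open import Relation.Nullary using (Dec; yes; no; ¬_; ¬?; contradiction)
import Relation.Nullary.Decidable as Dec
open import Relation.Nullary.Decidable using (_×-dec_; _⊎-dec_; decidable-stable)
open import Relation.Unary using (Pred; Decidable; _⊆_)

-- Finite sums and counting

𝟙 : ∀ {p} {P : Set p} → Dec P → ℕ
𝟙 (yes _) = 1
𝟙 (no _)  = 0

count : ∀ {n p} {P : Pred (Fin n) p} → Decidable P → ℕ
count {n} P? = ∑[ i < n ] 𝟙 (P? i)

∑-mono-≤ : ∀ {n} {f g : Fin n → ℕ} → (∀ i → f i ≤ g i) → sum f ≤ sum g
∑-mono-≤ {zero}  f≤g = z≤n
∑-mono-≤ {suc n} f≤g = +-mono-≤ (f≤g zero) (∑-mono-≤ (f≤g ∘ suc))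

∑-mono-< : ∀ {n} {f g : Fin n → ℕ} → (∀ i → f i ≤ g i) → ∀ k → f k < g k → sum f < sum g
∑-mono-< f≤g zero    lt = +-mono-<-≤ lt (∑-mono-≤ (f≤g ∘ suc))
∑-mono-< f≤g (suc k) lt = +-mono-≤-< (f≤g zero) (∑-mono-< (f≤g ∘ suc) k lt)

term≤∑ : ∀ {n} (f : Fin n → ℕ) i → f i ≤ sum f
term≤∑ f zero    = m≤m+n (f zero) _
term≤∑ f (suc i) = ≤-trans (term≤∑ (f ∘ suc) i) (m≤n+m _ (f zero))

two-terms≤∑ : ∀ {n} (f : Fin n → ℕ) {i j} → i ≢ j → f i + f j ≤ sum f
two-terms≤∑ f {zero}  {zero}  i≢j = contradiction refl i≢j
two-terms≤∑ f {zero}  {suc j} _   = +-monoʳ-≤ (f zero) (term≤∑ (f ∘ suc) j)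
two-terms≤∑ f {suc i} {zero}  _   =
  subst (_≤ sum f) (+-comm (f zero) (f (suc i))) (+-monoʳ-≤ (f zero) (term≤∑ (f ∘ suc) i))
two-terms≤∑ f {suc i} {suc j} i≢j =
  ≤-trans (two-terms≤∑ (f ∘ suc) (i≢j ∘ cong suc)) (m≤n+m _ (f zero))

∑-<⇒∃< : ∀ {n} (f g : Fin n → ℕ) → sum f < sum g → ∃ λ i → f i < g i
∑-<⇒∃< {zero}  f g ()
∑-<⇒∃< {suc n} f g lt with f zero <? g zero | sum (f ∘ suc) <? sum (g ∘ suc)
... | yes lt₀ | _       = zero , lt₀
... | no _    | yes lt′ = let i , lt″ = ∑-<⇒∃< (f ∘ suc) (g ∘ suc) lt′ in suc i , lt″
... | no ≮₀   | no ≮′   = contradiction lt (≤⇒≯ (+-mono-≤ (≮⇒≥ ≮₀) (≮⇒≥ ≮′)))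

∑-const-1 : ∀ n → ∑[ i < n ] 1 ≡ n
∑-const-1 zero    = refl
∑-const-1 (suc n) = cong suc (∑-const-1 n)


𝟙≤1 : ∀ {p} {P : Set p} (P? : Dec P) → 𝟙 P? ≤ 1
𝟙≤1 (yes _) = ≤-refl
𝟙≤1 (no _)  = z≤n

𝟙-mono : ∀ {p q} {P : Set p} {Q : Set q} (P? : Dec P) (Q? : Dec Q) → (P → Q) → 𝟙 P? ≤ 𝟙 Q?
𝟙-mono (yes p) (yes _) P⇒Q = ≤-refl
𝟙-mono (yes p) (no ¬q) P⇒Q = contradiction (P⇒Q p) ¬q
𝟙-mono (no _)  _       P⇒Q = z≤n

𝟙-yes : ∀ {p} {P : Set p} (P? : Dec P) → P → 𝟙 P? ≡ 1
𝟙-yes (yes _) _ = refl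
𝟙-yes (no ¬p) p = contradiction p ¬p

count-mono : ∀ {n p q} {P : Pred (Fin n) p} {Q : Pred (Fin n) q} (P? : Decidable P) (Q? : Decidable Q) →
             (∀ i → P i → Q i) → count P? ≤ count Q?
count-mono P? Q? P⇒Q = ∑-mono-≤ λ i → 𝟙-mono (P? i) (Q? i) (P⇒Q i)

count-mono-< : ∀ {n p q} {P : Pred (Fin n) p} {Q : Pred (Fin n) q} (P? : Decidable P) (Q? : Decidable Q) →
               (∀ i → P i → Q i) → ∀ k → Q k → ¬ P k → count P? < count Q?
count-mono-< {P = P} {Q} P? Q? P⇒Q k Qₖ ¬Pₖ = ∑-mono-< (λ i → 𝟙-mono (P? i) (Q? i) (P⇒Q i)) k (lt (P? k) (Q? k))
  where
  lt : (P? : Dec (P k)) (Q? : Dec (Q k)) → 𝟙 P? < 𝟙 Q?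
  lt (yes Pₖ) _        = contradiction Pₖ ¬Pₖ
  lt (no _)   (yes _)  = ≤-refl
  lt (no _)   (no ¬Qₖ) = contradiction Qₖ ¬Qₖ

2≤count : ∀ {n p} {P : Pred (Fin n) p} (P? : Decidable P) {i j} → i ≢ j → P i → P j → 2 ≤ count P?
2≤count P? {i} {j} i≢j Pᵢ Pⱼ =
  subst₂ (λ a b → a + b ≤ count P?) (𝟙-yes (P? i) Pᵢ) (𝟙-yes (P? j) Pⱼ) (two-terms≤∑ (𝟙 ∘ P?) i≢j)

1≤count : ∀ {n p} {P : Pred (Fin n) p} (P? : Decidable P) {i} → P i → 1 ≤ count P?
1≤count P? {i} Pᵢ = subst (_≤ count P?) (𝟙-yes (P? i) Pᵢ) (term≤∑ (𝟙 ∘ P?) i)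

count-pos⇒∃ : ∀ {n p} {P : Pred (Fin n) p} (P? : Decidable P) → 0 < count P? → ∃ P
count-pos⇒∃ {suc n} P? pos with P? zero
... | yes P₀ = zero , P₀
... | no _   = let i , Pᵢ = count-pos⇒∃ (P? ∘ suc) pos in suc i , Pᵢ

count≤n : ∀ {n p} {P : Pred (Fin n) p} (P? : Decidable P) → count P? ≤ n
count≤n {n} P? = subst (count P? ≤_) (∑-const-1 n) (∑-mono-≤ (𝟙≤1 ∘ P?))

count-none : ∀ {n p} {P : Pred (Fin n) p} (P? : Decidable P) → (∀ i → ¬ P i) → count P? ≡ 0
count-none {zero}  P? ¬P = refl
count-none {suc n} P? ¬P with P? zero
... | yes p₀ = contradiction p₀ (¬P zero)
... | no _   = count-none (P? ∘ suc) (¬P ∘ suc)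

count-unique≤1 : ∀ {n p} {P : Pred (Fin n) p} (P? : Decidable P) →
                 (∀ i j → P i → P j → i ≡ j) → count P? ≤ 1
count-unique≤1 {zero}  P? unique = z≤n
count-unique≤1 {suc n} P? unique with P? zero
... | yes p₀ = ≤-reflexive (cong suc (count-none (P? ∘ suc) λ i pᵢ → Fin.0≢1+n (unique zero (suc i) p₀ pᵢ)))
... | no _   = count-unique≤1 (P? ∘ suc) λ i j pᵢ pⱼ → Fin.suc-injective (unique (suc i) (suc j) pᵢ pⱼ)

count+count∁ : ∀ {n p} {P : Pred (Fin n) p} (P? : Decidable P) → count P? + count (¬? ∘ P?) ≡ n
count+count∁ {n} P? = begin
  count P? + count (¬? ∘ P?)          ≡⟨ ∑-distrib-+ (𝟙 ∘ P?) (𝟙 ∘ ¬? ∘ P?) ⟨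
  ∑[ i < n ] (𝟙 (P? i) + 𝟙 (¬? (P? i))) ≡⟨ sum-cong-≗ (𝟙+𝟙∁ ∘ P?) ⟩
  ∑[ i < n ] 1                         ≡⟨ ∑-const-1 n ⟩
  n                                    ∎
  where
  open ≡-Reasoning
  𝟙+𝟙∁ : ∀ {p} {P : Set p} (P? : Dec P) → 𝟙 P? + 𝟙 (¬? P?) ≡ 1
  𝟙+𝟙∁ (yes _) = refl
  𝟙+𝟙∁ (no _)  = refl

count≤count∩+count∁ : ∀ {n p q} {P : Pred (Fin n) p} {Q : Pred (Fin n) q}
  (P? : Decidable P) (Q? : Decidable Q) →
  count P? ≤ count (λ i → P? i ×-dec Q? i) + count (¬? ∘ Q?)
count≤count∩+count∁ {n} P? Q? = begin
  count P?                                                 ≤⟨ ∑-mono-≤ (λ i → split (P? i) (Q? i)) ⟩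
  ∑[ i < n ] (𝟙 (P? i ×-dec Q? i) + 𝟙 (¬? (Q? i)))
    ≡⟨ ∑-distrib-+ (λ i → 𝟙 (P? i ×-dec Q? i)) (𝟙 ∘ ¬? ∘ Q?) ⟩
  count (λ i → P? i ×-dec Q? i) + count (¬? ∘ Q?)          ∎
  where
  open ≤-Reasoning
  split : ∀ {p q} {P : Set p} {Q : Set q} (P? : Dec P) (Q? : Dec Q) → 𝟙 P? ≤ 𝟙 (P? ×-dec Q?) + 𝟙 (¬? Q?)
  split (yes _) (yes _) = ≤-refl
  split (yes _) (no _)  = ≤-refl
  split (no _)  _       = z≤n

module Pigeonhole {m n : ℕ} {r : Level} (Hit : Fin m → Fin n → Set r) (hit? : ∀ k i → Dec (Hit k i))
                  (hits-once : ∀ k i j → Hit k i → Hit k j → i ≡ j) (w : Fin m → ℕ) where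

  load : Fin n → ℕ
  load i = ∑[ k < m ] (𝟙 (hit? k i) * w k)

  ∑load≤∑w : ∑[ i < n ] load i ≤ ∑[ k < m ] w k
  ∑load≤∑w = begin
    ∑[ i < n ] ∑[ k < m ] (𝟙 (hit? k i) * w k)  ≡⟨ ∑-comm (λ i k → 𝟙 (hit? k i) * w k) ⟩
    ∑[ k < m ] ∑[ i < n ] (𝟙 (hit? k i) * w k)  ≡⟨ sum-cong-≗ (λ k → *-distribʳ-sum (w k) (𝟙 ∘ hit? k)) ⟨
    ∑[ k < m ] (count (hit? k) * w k)
      ≤⟨ ∑-mono-≤ (λ k → *-monoˡ-≤ (w k) (count-unique≤1 (hit? k) (hits-once k))) ⟩
    ∑[ k < m ] (1 * w k)                        ≡⟨ sum-cong-≗ (λ k → *-identityˡ (w k)) ⟩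
    ∑[ k < m ] w k                              ∎
    where open ≤-Reasoning

  pigeonhole : ∀ {j} {J : Pred (Fin n) j} (J? : Decidable J) K →
               ∑[ k < m ] w k < K * count J? → ∃ λ i → J i × load i < K
  pigeonhole {J = J} J? K lt = select (∑-<⇒∃< load (λ i → K * 𝟙 (J? i)) ∑load<K·J)
    where
    ∑load<K·J : ∑[ i < n ] load i < ∑[ i < n ] (K * 𝟙 (J? i))
    ∑load<K·J = ≤-<-trans ∑load≤∑w (subst (_ <_) (*-distribˡ-sum K (𝟙 ∘ J?)) lt)
    select : (∃ λ i → load i < K * 𝟙 (J? i)) → ∃ λ i → J i × load i < K
    select (i , lt′) with J? i
    ... | yes Jᵢ = i , Jᵢ , subst (load i <_) (*-identityʳ K) lt′
    ... | no _   = contradiction (subst (load i <_) (*-zeroʳ K) lt′) λ ()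

  pigeonhole₁ : ∀ {j} {J : Pred (Fin n) j} (J? : Decidable J) →
                ∑[ k < m ] w k < count J? → ∃ λ i → J i × load i < 1
  pigeonhole₁ J? lt = pigeonhole J? 1 (subst (_ <_) (sym (*-identityˡ (count J?))) lt)

  w≤load : ∀ {k i} → Hit k i → w k ≤ load i
  w≤load {k} {i} h = subst (_≤ load i) (trans (cong (_* w k) (𝟙-yes (hit? k i) h)) (*-identityˡ (w k)))
                            (term≤∑ (λ k′ → 𝟙 (hit? k′ i) * w k′) k)

  light⇒unhit : ∀ {i K} → load i < K → ∀ k → K ≤ w k → ¬ Hit k i
  light⇒unhit light k heavy h = <⇒≱ light (≤-trans heavy (w≤load h))

-- Coordinates and Hamming distance

flip : ∀ {n} → Vertex n → Fin n → Vertex n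
flip x i = updateAt x i not

module _ {n : ℕ} (x : Vertex n) where

  lookup-flip : ∀ i → lookup (flip x i) i ≡ not (lookup x i)
  lookup-flip i = lookup∘updateAt i x

  lookup-flip-other : ∀ {i j} → i ≢ j → lookup (flip x i) j ≡ lookup x j
  lookup-flip-other {i} {j} i≢j = lookup∘updateAt′ j i (i≢j ∘ sym) x

  flip-moves : ∀ i → lookup (flip x i) i ≢ lookup x i
  flip-moves i eq = not-¬ refl (trans (sym eq) (lookup-flip i))

Agree Differ : ∀ {n} → Vertex n → Vertex n → Fin n → Set
Agree  x y i = lookup x i ≡ lookup y i
Differ x y i = lookup x i ≢ lookup y i

agree? : ∀ {n} (x y : Vertex n) → Decidable (Agree x y)
agree? x y i = lookup x i ≟ lookup y i

differ? : ∀ {n} (x y : Vertex n) → Decidable (Differ x y)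
differ? x y = ¬? ∘ agree? x y

hamming≡count-differ : ∀ {n} (x y : Vertex n) → hamming x y ≡ count (differ? x y)
hamming≡count-differ []       []       = refl
hamming≡count-differ (a ∷ x) (b ∷ y) with a ≟ b
... | yes _ = hamming≡count-differ x y
... | no _  = cong suc (hamming≡count-differ x y)

hamming-self : ∀ {n} (x : Vertex n) → hamming x x ≡ 0
hamming-self []      = refl
hamming-self (a ∷ x) with a ≟ a
... | yes _   = hamming-self x
... | no a≢a  = contradiction refl a≢a

hamming-self≤1 : ∀ {n} (x : Vertex n) → hamming x x ≤ 1
hamming-self≤1 x = subst (_≤ 1) (sym (hamming-self x)) z≤n

hamming-sym : ∀ {n} (x y : Vertex n) → hamming x y ≡ hamming y x
hamming-sym []      []      = refl
hamming-sym (a ∷ x) (b ∷ y) with a ≟ b | b ≟ a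
... | yes _   | yes _   = hamming-sym x y
... | no _    | no _    = cong suc (hamming-sym x y)
... | yes a≡b | no b≢a  = contradiction (sym a≡b) b≢a
... | no a≢b  | yes b≡a = contradiction (sym b≡a) a≢b

hamming≡0⇒≡ : ∀ {n} (x y : Vertex n) → hamming x y ≡ 0 → x ≡ y
hamming≡0⇒≡ []      []      _ = refl
hamming≡0⇒≡ (a ∷ x) (b ∷ y) h with a ≟ b
... | yes a≡b = cong₂ _∷_ a≡b (hamming≡0⇒≡ x y h)

hamming≤n : ∀ {n} (x y : Vertex n) → hamming x y ≤ n
hamming≤n x y = subst (_≤ _) (sym (hamming≡count-differ x y)) (count≤n (differ? x y))

differ-twice⇒2≤hamming : ∀ {n} (x y : Vertex n) {i j} → i ≢ j → Differ x y i → Differ x y j → 2 ≤ hamming x y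
differ-twice⇒2≤hamming x y i≢j dᵢ dⱼ =
  subst (2 ≤_) (sym (hamming≡count-differ x y)) (2≤count (differ? x y) i≢j dᵢ dⱼ)

hamming-flip-differ : ∀ {n} (x y : Vertex n) i → Differ x y i → suc (hamming (flip x i) y) ≡ hamming x y
hamming-flip-differ (a ∷ x) (b ∷ y) zero a≢b with a ≟ b | not a ≟ b
... | yes a≡b | _        = contradiction a≡b a≢b
... | no _    | yes _    = refl
... | no _    | no na≢b  = contradiction (sym (¬-not (a≢b ∘ sym))) na≢b
hamming-flip-differ (a ∷ x) (b ∷ y) (suc i) d with a ≟ b
... | yes _ = hamming-flip-differ x y i d
... | no _  = cong suc (hamming-flip-differ x y i d)

hamming-flip-agree : ∀ {n} (x y : Vertex n) i → Agree x y i → hamming (flip x i) y ≡ suc (hamming x y)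
hamming-flip-agree (a ∷ x) (b ∷ y) zero a≡b with a ≟ b | not a ≟ b
... | no a≢b  | _        = contradiction a≡b a≢b
... | yes _   | yes na≡b = contradiction (trans na≡b (sym a≡b)) (not-¬ refl ∘ sym)
... | yes _   | no _     = refl
hamming-flip-agree (a ∷ x) (b ∷ y) (suc i) a≡b with a ≟ b
... | yes _ = hamming-flip-agree x y i a≡b
... | no _  = cong suc (hamming-flip-agree x y i a≡b)

hamming-flip-differʳ : ∀ {n} (x y : Vertex n) i → Differ x y i → suc (hamming x (flip y i)) ≡ hamming x y
hamming-flip-differʳ x y i d = begin
  suc (hamming x (flip y i)) ≡⟨ cong suc (hamming-sym x (flip y i)) ⟩
  suc (hamming (flip y i) x) ≡⟨ hamming-flip-differ y x i (d ∘ sym) ⟩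
  hamming y x                ≡⟨ hamming-sym y x ⟩
  hamming x y                ∎
  where open ≡-Reasoning

hamming-flip-agreeʳ : ∀ {n} (x y : Vertex n) i → Agree x y i → hamming x (flip y i) ≡ suc (hamming x y)
hamming-flip-agreeʳ x y i a = begin
  hamming x (flip y i)       ≡⟨ hamming-sym x (flip y i) ⟩
  hamming (flip y i) x       ≡⟨ hamming-flip-agree y x i (sym a) ⟩
  suc (hamming y x)          ≡⟨ cong suc (hamming-sym y x) ⟩
  suc (hamming x y)          ∎
  where open ≡-Reasoning

hamming-flip-≤ : ∀ {n} (x y : Vertex n) i → hamming x (flip y i) ≤ suc (hamming x y)
hamming-flip-≤ x y i with agree? x y i
... | yes a = ≤-reflexive (hamming-flip-agreeʳ x y i a)
... | no d  = ≤-trans (n≤1+n _) (≤-trans (≤-reflexive (hamming-flip-differʳ x y i d)) (n≤1+n _))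

hamming-flip-both : ∀ {n} (x y : Vertex n) i → hamming (flip x i) (flip y i) ≡ hamming x y
hamming-flip-both (a ∷ x) (b ∷ y) zero with a ≟ b | not a ≟ not b
... | yes _   | yes _     = refl
... | no _    | no _      = refl
... | yes a≡b | no na≢nb  = contradiction (cong not a≡b) na≢nb
... | no a≢b  | yes na≡nb = contradiction (not-injective na≡nb) a≢b
hamming-flip-both (a ∷ x) (b ∷ y) (suc i) with a ≟ b
... | yes _ = hamming-flip-both x y i
... | no _  = cong suc (hamming-flip-both x y i)

hamming-++ : ∀ {k m} (x y : Vertex k) (w w′ : Vertex m) → hamming (x ++ w) (y ++ w′) ≡ hamming x y + hamming w w′
hamming-++ []      []      w w′ = refl
hamming-++ (a ∷ x) (b ∷ y) w w′ with a ≟ b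
... | yes _ = hamming-++ x y w w′
... | no _  = cong suc (hamming-++ x y w w′)

flips-far : ∀ {n} (x : Vertex n) {i j} → i ≢ j → 2 ≤ hamming (flip x i) (flip x j)
flips-far x {i} {j} i≢j = differ-twice⇒2≤hamming (flip x i) (flip x j) i≢j
  (λ e → flip-moves x i (trans e (lookup-flip-other x (i≢j ∘ sym))))
  (λ e → flip-moves x j (trans (sym e) (lookup-flip-other x i≢j)))

hamming-flip-flip : ∀ {n} (u v : Vertex n) {i j} → i ≢ j → Differ u v i → Differ u v j →
                    2 + hamming (flip u i) (flip v j) ≡ hamming u v
hamming-flip-flip u v {i} {j} i≢j dᵢ dⱼ =
  trans (cong suc (hamming-flip-differʳ (flip u i) v j (dⱼ ∘ trans (sym (lookup-flip-other u i≢j)))))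
        (hamming-flip-differ u v i dᵢ)

flip-closer : ∀ {n} (u v : Vertex n) {i k} → Differ u v i → hamming u v ≡ suc k → hamming (flip u i) v ≡ k
flip-closer u v {i} dᵢ h = suc-injective (trans (hamming-flip-differ u v i dᵢ) h)

flip-closer-right : ∀ {n} (u v : Vertex n) {i k} → Differ u v i → hamming u v ≡ suc k → hamming u (flip v i) ≡ k
flip-closer-right u v {i} dᵢ h = suc-injective (trans (hamming-flip-differʳ u v i dᵢ) h)

adj-flip : ∀ {n} (x : Vertex n) i → Adj x (flip x i)
adj-flip x i = trans (hamming-sym x (flip x i))
                     (trans (hamming-flip-agree x x i refl) (cong suc (hamming-self x)))

adj-sym : ∀ {n} {x y : Vertex n} → Adj x y → Adj y x
adj-sym {x = x} {y} = trans (hamming-sym y x)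

adj⇒flip : ∀ {n} (x y : Vertex n) → Adj x y → ∃ λ i → y ≡ flip x i
adj⇒flip []      []      ()
adj⇒flip (a ∷ x) (b ∷ y) h with a ≟ b
... | yes refl = let i , y≡ = adj⇒flip x y h in suc i , cong (a ∷_) y≡
... | no a≢b   = zero , cong₂ _∷_ (¬-not (a≢b ∘ sym)) (sym (hamming≡0⇒≡ x y (suc-injective h)))

-- Walks

module _ {n : ℕ} {S : Set} {vs : S → List (Vertex n)} {F : List S} where

  walk-start : ∀ {u v l} → Walk vs F u v l → Survives vs F u
  walk-start (here su)     = su
  walk-start (step su _ _) = su

  snoc : ∀ {u w v l} → Walk vs F u w l → Adj w v → Survives vs F v → Walk vs F u v (suc l)
  snoc (here sw)         w~v sv = step sw w~v (here sv)
  snoc (step su u~x walk) w~v sv = step su u~x (snoc walk w~v sv)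

  walk-map : ∀ {T : Set} {vt : T → List (Vertex n)} {G : List T} → Survives vs F ⊆ Survives vt G →
             ∀ {u v l} → Walk vs F u v l → Walk vt G u v l
  walk-map survives (here alive)          = here (survives alive)
  walk-map survives (step alive u~x walk) = step (survives alive) u~x (walk-map survives walk)

  walk-lipschitz : (φ : Vertex n → ℕ) →
    (∀ x y → Survives vs F x → Survives vs F y → Adj x y → φ y ≤ suc (φ x)) →
    ∀ {u v l} → Walk vs F u v l → φ v ≤ φ u + l
  walk-lipschitz φ φ-step {u} (here _) = ≤-reflexive (sym (+-identityʳ (φ u)))
  walk-lipschitz φ φ-step {u} (step {v = x} {l = l} su u~x walk) = begin
    _             ≤⟨ walk-lipschitz φ φ-step walk ⟩
    φ x + l       ≤⟨ +-monoˡ-≤ l (φ-step u x su (walk-start walk) u~x) ⟩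
    suc (φ u) + l ≡⟨ +-suc (φ u) l ⟨
    φ u + suc l   ∎
    where open ≤-Reasoning

  hamming≤length : ∀ {u v l} → Walk vs F u v l → hamming u v ≤ l
  hamming≤length {u} {v} {l} walk = subst (λ h₀ → hamming u v ≤ h₀ + l) (hamming-self u)
    (walk-lipschitz (hamming u) step-bound walk)
    where
    step-bound : ∀ x y → _ → _ → Adj x y → hamming u y ≤ suc (hamming u x)
    step-bound x y _ _ x~y with adj⇒flip x y x~y
    ... | i , refl = hamming-flip-≤ u x i

  diamIs-from-bounds : ∀ {d u v} → DiamAtMost vs F d → Survives vs F u → Survives vs F v →
                       (∀ l → Walk vs F u v l → d ≤ l) → DiamIs vs F d
  diamIs-from-bounds {u = u} {v} diam alive-u alive-v longest =
    let l , l≤d , walk = diam u v alive-u alive-v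
    in  diam , u , v , alive-u , alive-v , subst (Walk vs F u v) (≤-antisym l≤d (longest l walk)) walk , longest

-- Intervals and pieces

-- A record, so that the endpoints and the vertex can be inferred from a proof.
record Between {n} (u v x : Vertex n) : Set where
  constructor between
  field at : ∀ i → Agree x u i ⊎ Agree x v i

open Between

between? : ∀ {n} (u v : Vertex n) → Decidable (Between u v)
between? u v x = Dec.map′ between at (Fin.all? λ i → agree? x u i ⊎-dec agree? x v i)

module _ {n : ℕ} (u v : Vertex n) where

  between-left : Between u v u
  between-left .at i = inj₁ refl

  between-right : Between u v v
  between-right .at i = inj₂ refl

  flip-between : ∀ {i} → Differ u v i → Between u v (flip u i)
  flip-between {i} dᵢ .at j with i Fin.≟ j
  ... | yes refl = inj₂ (trans (lookup-flip u i) (sym (¬-not (dᵢ ∘ sym))))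
  ... | no i≢j   = inj₁ (lookup-flip-other u i≢j)

  flip-between-right : ∀ {i} → Differ u v i → Between u v (flip v i)
  flip-between-right {i} dᵢ .at j with i Fin.≟ j
  ... | yes refl = inj₁ (trans (lookup-flip v i) (sym (¬-not dᵢ)))
  ... | no i≢j   = inj₂ (lookup-flip-other v i≢j)

  between-flip⇒agree : ∀ {i} x → Differ u v i → Between (flip u i) v x → Agree x v i
  between-flip⇒agree {i} x dᵢ x∈ with at x∈ i
  ... | inj₁ x≡uᵢ = trans x≡uᵢ (trans (lookup-flip u i) (sym (¬-not (dᵢ ∘ sym))))
  ... | inj₂ x≡v  = x≡v

  between-flip-right⇒agree : ∀ {i} x → Differ u v i → Between u (flip v i) x → Agree x u i
  between-flip-right⇒agree {i} x dᵢ x∈ with at x∈ i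
  ... | inj₁ x≡u  = x≡u
  ... | inj₂ x≡vᵢ = trans x≡vᵢ (trans (lookup-flip v i) (sym (¬-not dᵢ)))

  between-flip-right⊆ : ∀ {i} → Differ u v i → Between u (flip v i) ⊆ Between u v
  between-flip-right⊆ {i} dᵢ {x} x∈ .at j with i Fin.≟ j
  ... | yes refl = inj₁ (between-flip-right⇒agree x dᵢ x∈)
  ... | no i≢j   = Sum.map₂ (λ x≡vᵢ → trans x≡vᵢ (lookup-flip-other v i≢j)) (at x∈ j)

  shifted-coord : ∀ {j x} → Agree u v j → Between (flip u j) (flip v j) x → lookup x j ≡ not (lookup u j)
  shifted-coord {j} uⱼ≡vⱼ x∈ with at x∈ j
  ... | inj₁ x≡uʲ = trans x≡uʲ (lookup-flip u j)
  ... | inj₂ x≡vʲ = trans x≡vʲ (trans (lookup-flip v j) (cong not (sym uⱼ≡vⱼ)))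

  shifted-other : ∀ {j j′ x} → j ≢ j′ → Agree u v j′ → Between (flip u j) (flip v j) x → Agree x u j′
  shifted-other {j} {j′} j≢j′ uⱼ′≡vⱼ′ x∈ with at x∈ j′
  ... | inj₁ x≡uʲ = trans x≡uʲ (lookup-flip-other u j≢j′)
  ... | inj₂ x≡vʲ = trans x≡vʲ (trans (lookup-flip-other v j≢j′) (sym uⱼ′≡vⱼ′))

  shifted-intervals-far : ∀ {j j′ x y} → j ≢ j′ → Agree u v j → Agree u v j′ →
    Between (flip u j) (flip v j) x → Between (flip u j′) (flip v j′) y → 2 ≤ hamming x y
  shifted-intervals-far {j} {j′} {x} {y} j≢j′ aⱼ aⱼ′ x∈ y∈ = differ-twice⇒2≤hamming x y j≢j′
    (λ e → not-¬ (shifted-other (j≢j′ ∘ sym) aⱼ y∈) (trans (sym e) (shifted-coord aⱼ x∈)))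
    (λ e → not-¬ (shifted-other j≢j′ aⱼ′ x∈) (trans e (shifted-coord aⱼ′ y∈)))

  between-flip⊆ : ∀ {i} → Differ u v i → Between (flip u i) v ⊆ Between u v
  between-flip⊆ {i} dᵢ {x} x∈ .at j with i Fin.≟ j
  ... | yes refl = inj₂ (between-flip⇒agree x dᵢ x∈)
  ... | no i≢j   = Sum.map₁ (λ x≡uᵢ → trans x≡uᵢ (lookup-flip-other u i≢j)) (at x∈ j)

module _ {n : ℕ} where

  piece-diameter : (p : Q1Sub n) {x y : Vertex n} → x ∈ subVerts p → y ∈ subVerts p → hamming x y ≤ 1
  piece-diameter (vtx u)        (here refl)         (here refl)         = hamming-self≤1 u
  piece-diameter (edge u v _)   (here refl)         (here refl)         = hamming-self≤1 u
  piece-diameter (edge u v u~v) (here refl)         (there (here refl)) = ≤-reflexive u~v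
  piece-diameter (edge u v u~v) (there (here refl)) (here refl)         = ≤-reflexive (adj-sym {x = u} u~v)
  piece-diameter (edge u v _)   (there (here refl)) (there (here refl)) = hamming-self≤1 v

  far⇒not-in-one-piece : (p : Q1Sub n) {x y : Vertex n} → 2 ≤ hamming x y →
                         x ∈ subVerts p → y ∈ subVerts p → ⊥
  far⇒not-in-one-piece p far x∈p y∈p = ≤⇒≯ (piece-diameter p x∈p y∈p) far

  one-per-piece : ∀ (p : Q1Sub n) {m} {i j : Fin m} {x y} → (i ≢ j → 2 ≤ hamming x y) →
                  x ∈ subVerts p → y ∈ subVerts p → i ≡ j
  one-per-piece p {i = i} {j} far x∈p y∈p =
    decidable-stable (i Fin.≟ j) λ i≢j → far⇒not-in-one-piece p (far i≢j) x∈p y∈p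

  Touches : Vertex n → Vertex n → Q1Sub n → Set
  Touches u v p = Any (Between u v) (subVerts p)

  touches? : (u v : Vertex n) → Decidable (Touches u v)
  touches? u v p = Any.any? (between? u v) (subVerts p)

  EdgeWithin : Vertex n → Vertex n → Q1Sub n → Set
  EdgeWithin u v (vtx _)      = ⊥
  EdgeWithin u v (edge a b _) = Between u v a × Between u v b

  edgeWithin? : (u v : Vertex n) → Decidable (EdgeWithin u v)
  edgeWithin? u v (vtx _)      = no λ ()
  edgeWithin? u v (edge a b _) = between? u v a ×-dec between? u v b

  module _ (u v : Vertex n) where

    member-touches : ∀ p {y} → y ∈ subVerts p → Between u v y → Touches u v p
    member-touches p = lose

    edgeWithin⇒touches : ∀ p → EdgeWithin u v p → Touches u v p
    edgeWithin⇒touches (edge a b _) (a∈ , _) = here a∈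

    edgeWithin-member : ∀ p {y} → EdgeWithin u v p → y ∈ subVerts p → Between u v y
    edgeWithin-member (edge a b _) (a∈ , b∈) (here refl)         = a∈
    edgeWithin-member (edge a b _) (a∈ , b∈) (there (here refl)) = b∈

    two-between⇒edgeWithin : ∀ p {y y′} → y ≢ y′ → y ∈ subVerts p → y′ ∈ subVerts p →
                             Between u v y → Between u v y′ → EdgeWithin u v p
    two-between⇒edgeWithin (vtx _)      y≢y′ (here refl)         (here refl)         _  _   = contradiction refl y≢y′
    two-between⇒edgeWithin (edge a b _) y≢y′ (here refl)         (here refl)         _  _   = contradiction refl y≢y′
    two-between⇒edgeWithin (edge a b _) y≢y′ (here refl)         (there (here refl)) a∈ b∈  = a∈ , b∈
    two-between⇒edgeWithin (edge a b _) y≢y′ (there (here refl)) (here refl)         b∈ a∈  = a∈ , b∈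
    two-between⇒edgeWithin (edge a b _) y≢y′ (there (here refl)) (there (here refl)) _  _   = contradiction refl y≢y′

  module _ (u v u′ v′ : Vertex n) (I′⊆I : Between u′ v′ ⊆ Between u v) where

    touches-mono : ∀ p → Touches u′ v′ p → Touches u v p
    touches-mono p = Any.map I′⊆I

    edgeWithin-mono : ∀ p → EdgeWithin u′ v′ p → EdgeWithin u v p
    edgeWithin-mono (edge a b _) (a∈ , b∈) = I′⊆I a∈ , I′⊆I b∈

  Fixes : Q1Sub n → Fin n → Set
  Fixes (vtx _)      i = ⊤
  Fixes (edge a b _) i = Agree a b i

  fixes? : (p : Q1Sub n) → Decidable (Fixes p)
  fixes? (vtx _)      i = yes tt
  fixes? (edge a b _) i = agree? a b i

  fixes-coord : ∀ p {i x y} → Fixes p i → x ∈ subVerts p → y ∈ subVerts p → Agree x y i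
  fixes-coord (vtx _)      _   (here refl)         (here refl)         = refl
  fixes-coord (edge a b _) _   (here refl)         (here refl)         = refl
  fixes-coord (edge a b _) a≡b (here refl)         (there (here refl)) = a≡b
  fixes-coord (edge a b _) a≡b (there (here refl)) (here refl)         = sym a≡b
  fixes-coord (edge a b _) _   (there (here refl)) (there (here refl)) = refl

  moves-at-most-once : ∀ p → count (¬? ∘ fixes? p) ≤ 1
  moves-at-most-once (vtx x)        = count-unique≤1 (¬? ∘ fixes? (vtx x)) λ i j moves _ → contradiction tt moves
  moves-at-most-once (edge a b a~b) with adj⇒flip a b a~b
  ... | c , refl = count-unique≤1 (¬? ∘ fixes? (edge a (flip a c) a~b))
                     λ i j mᵢ mⱼ → trans (moved⇒c mᵢ) (sym (moved⇒c mⱼ))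
    where
    moved⇒c : ∀ {i} → ¬ Agree a (flip a c) i → i ≡ c
    moved⇒c {i} moved with i Fin.≟ c
    ... | yes i≡c = i≡c
    ... | no i≢c  = contradiction (sym (lookup-flip-other a {c} {i} (i≢c ∘ sym))) moved

-- Short walks avoiding few pieces

detour-arithmetic : ∀ K g o a → suc K ≤ g → g + o + 2 ≤ suc K + a → g + suc K * o < suc K * a
detour-arithmetic K _ o a K<g room with e , refl ← m≤n⇒∃[o]m+o≡n K<g
  with r , refl ← m≤n⇒∃[o]m+o≡n (+-cancelˡ-≤ (suc K) (e + (o + 2)) a
                                   (subst (_≤ suc K + a) (trans (+-assoc (suc K + e) o 2) (+-assoc (suc K) e (o + 2))) room))
  = subst (suc K + e + suc K * o <_) (identity K e o r) (m<m+n _ (s≤s z≤n))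
  where
  identity : ∀ K e o r → suc K + e + suc K * o + suc (r + K * e + K + K * r) ≡ suc K * (e + (o + 2) + r)
  identity = solve-∀

module Faults {n : ℕ} (F : List (Q1Sub n)) where

  open import Data.List.Membership.DecPropositional (Vec.≡-dec {n = n} _≟_) using (_∈?_)

  Alive : Vertex n → Set
  Alive = Survives subVerts F

  -- Pieces are indexed by their position in F, so that counting them is a finite sum.
  piece : Fin (length F) → Q1Sub n
  piece = List.lookup F

  #_ : ∀ {p} {P : Pred (Q1Sub n) p} → Decidable P → ℕ
  # P? = count (P? ∘ piece)

  dead⇒in-piece : ∀ {x} → Removed subVerts F x → ∃ λ k → x ∈ subVerts (piece k)
  dead⇒in-piece r = Any.index r , lookup-index r

  alive-if-unhit : ∀ {x} → (∀ k → x ∉ subVerts (piece k)) → Alive x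
  alive-if-unhit unhit r = let k , x∈ = dead⇒in-piece r in unhit k x∈

  module Neighbours (u v : Vertex n) where

    Hit : Fin (length F) → Fin n → Set
    Hit k i = Differ u v i × flip u i ∈ subVerts (piece k)

    hit? : ∀ k i → Dec (Hit k i)
    hit? k i = differ? u v i ×-dec (flip u i ∈? subVerts (piece k))

    hits-once : ∀ k i j → Hit k i → Hit k j → i ≡ j
    hits-once k i j (_ , uⁱ∈) (_ , uʲ∈) = one-per-piece (piece k) (flips-far u) uⁱ∈ uʲ∈

    step-towards : # (touches? u v) < hamming u v → ∃ λ i → Differ u v i × Alive (flip u i)
    step-towards few =
      let i , dᵢ , light = pigeonhole₁ (differ? u v) (subst (# (touches? u v) <_) (hamming≡count-differ u v) few)
      in  i , dᵢ , alive-if-unhit λ k uⁱ∈ → light⇒unhit light k (touching dᵢ uⁱ∈) (dᵢ , uⁱ∈)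
      where
      open Pigeonhole Hit hit? hits-once (λ k → 𝟙 (touches? u v (piece k)))
      touching : ∀ {i k} → Differ u v i → flip u i ∈ subVerts (piece k) → 1 ≤ 𝟙 (touches? u v (piece k))
      touching {k = k} dᵢ uⁱ∈ =
        ≤-reflexive (sym (𝟙-yes (touches? u v (piece k)) (member-touches u v (piece k) uⁱ∈ (flip-between u v dᵢ))))

  open Neighbours public using (step-towards)

  module Avoiding (d : ℕ) (u v : Vertex n) (h : hamming u v ≡ 3 + d)
                  (kₚ : Fin (length F)) (x : Vertex n) (x∈p : x ∈ subVerts (piece kₚ)) (x∈I : Between u v x)
                  (within-bound : # (edgeWithin? u v) ≤ d ⊎ EdgeWithin u v (piece kₚ) × # (edgeWithin? u v) ≤ 1 + d)
                  (touch-bound : # (touches? u v) ≤ 2 + d) where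

    p : Q1Sub n
    p = piece kₚ

    -- The half of the interval split along i that lies away from x misses p when
    -- p fixes coordinate i; away i is its endpoint next to u or to v.
    away : ∀ i → Dec (Agree x u i) → Vertex n
    away i (yes _) = flip u i
    away i (no _)  = flip v i

    away-between : ∀ {i} → Differ u v i → ∀ a → Between u v (away i a)
    away-between dᵢ (yes _) = flip-between u v dᵢ
    away-between dᵢ (no _)  = flip-between-right u v dᵢ

    x-agrees-v : ∀ {i} → ¬ Agree x u i → Agree x v i
    x-agrees-v {i} x≢u with at x∈I i
    ... | inj₁ x≡u = contradiction x≡u x≢u
    ... | inj₂ x≡v = x≡v

    away-moves : ∀ {i} → (a : Dec (Agree x u i)) → Differ (away i a) x i
    away-moves {i} (yes x≡u) e = flip-moves u i (trans e x≡u)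
    away-moves {i} (no x≢u)  e = flip-moves v i (trans e (x-agrees-v x≢u))

    Separating : Fin n → Set
    Separating i = Differ u v i × Fixes p i

    separating? : Decidable Separating
    separating? i = differ? u v i ×-dec fixes? p i

    many-fixed : 2 + d ≤ count separating?
    many-fixed = ≤-pred (begin
      3 + d                                      ≡⟨ trans (sym h) (hamming≡count-differ u v) ⟩
      count (differ? u v)                        ≤⟨ count≤count∩+count∁ (differ? u v) (fixes? p) ⟩
      count separating? + count (¬? ∘ fixes? p)  ≤⟨ +-monoʳ-≤ (count separating?) (moves-at-most-once p) ⟩
      count separating? + 1                      ≡⟨ +-comm (count separating?) 1 ⟩
      suc (count separating?)                    ∎)
      where open ≤-Reasoning

    target : Fin n → Vertex n
    target i = away i (agree? x u i)

    Hit : Fin (length F) → Fin n → Set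
    Hit k i = Separating i × target i ∈ subVerts (piece k)

    hit? : ∀ k i → Dec (Hit k i)
    hit? k i = separating? i ×-dec (target i ∈? subVerts (piece k))

    p-unhit : ∀ i → ¬ Hit kₚ i
    p-unhit i ((_ , fᵢ) , t∈p) = away-moves (agree? x u i) (fixes-coord p fᵢ t∈p x∈p)

    -- uⁱ and vʲ are at distance 1 + d, so only for d = 0 can they share a piece,
    -- which is then a second edge inside the interval.
    mixed-impossible : ∀ {k i j} → i ≢ j → Differ u v i → Differ u v j → k ≢ kₚ →
                       flip u i ∈ subVerts (piece k) → flip v j ∈ subVerts (piece k) → ⊥
    mixed-impossible {k} {i} {j} i≢j dᵢ dⱼ k≢kₚ uⁱ∈ vʲ∈ = excluded within-bound
      where
      close : hamming (flip u i) (flip v j) ≡ 1 + d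
      close = suc-injective (suc-injective (trans (hamming-flip-flip u v i≢j dᵢ dⱼ) h))
      d≡0 : d ≡ 0
      d≡0 = n≤0⇒n≡0 (≤-pred (subst (_≤ 1) close (piece-diameter (piece k) uⁱ∈ vʲ∈)))
      q-within : EdgeWithin u v (piece k)
      q-within = two-between⇒edgeWithin u v (piece k)
        (λ e → 0≢1+n (trans (sym (hamming-self (flip u i))) (trans (cong (hamming (flip u i)) e) close)))
        uⁱ∈ vʲ∈ (flip-between u v dᵢ) (flip-between-right u v dⱼ)
      excluded : # (edgeWithin? u v) ≤ d ⊎ EdgeWithin u v p × # (edgeWithin? u v) ≤ 1 + d → ⊥
      excluded (inj₁ ≤d) = <⇒≱ (1≤count (edgeWithin? u v ∘ piece) q-within) (subst (_ ≤_) d≡0 ≤d)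
      excluded (inj₂ (p-within , ≤1+d)) =
        <⇒≱ (2≤count (edgeWithin? u v ∘ piece) k≢kₚ q-within p-within) (subst (λ d′ → _ ≤ 1 + d′) d≡0 ≤1+d)

    hits-once : ∀ k i j → Hit k i → Hit k j → i ≡ j
    hits-once k i j hitᵢ@((dᵢ , _) , tᵢ∈) ((dⱼ , _) , tⱼ∈) =
      decidable-stable (i Fin.≟ j) λ i≢j → apart i≢j dᵢ dⱼ k≢kₚ (agree? x u i) (agree? x u j) tᵢ∈ tⱼ∈
      where
      k≢kₚ : k ≢ kₚ
      k≢kₚ refl = p-unhit i hitᵢ
      apart : ∀ {i j} → i ≢ j → Differ u v i → Differ u v j → k ≢ kₚ → ∀ a b →
              away i a ∈ subVerts (piece k) → away j b ∈ subVerts (piece k) → ⊥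
      apart i≢j dᵢ dⱼ _   (yes _) (yes _) = far⇒not-in-one-piece (piece k) (flips-far u i≢j)
      apart i≢j dᵢ dⱼ _   (no _)  (no _)  = far⇒not-in-one-piece (piece k) (flips-far v i≢j)
      apart i≢j dᵢ dⱼ k≢p (yes _) (no _)  = mixed-impossible i≢j dᵢ dⱼ k≢p
      apart i≢j dᵢ dⱼ k≢p (no _)  (yes _) = λ vⁱ∈ uʲ∈ → mixed-impossible (i≢j ∘ sym) dⱼ dᵢ k≢p uʲ∈ vⁱ∈

    contains-target? : ∀ k → Dec (∃ (Hit k))
    contains-target? k = Fin.any? (hit? k)

    open Pigeonhole Hit hit? hits-once (λ k → 𝟙 (contains-target? k))

    p-touches : Touches u v p
    p-touches = member-touches u v p x∈p x∈I

    few-hits : count contains-target? < count separating?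
    few-hits = begin-strict
      count contains-target?  <⟨ count-mono-< contains-target? (touches? u v ∘ piece) target-touches
                                   kₚ p-touches (λ (i , hit) → p-unhit i hit) ⟩
      # (touches? u v)        ≤⟨ touch-bound ⟩
      2 + d                   ≤⟨ many-fixed ⟩
      count separating?       ∎
      where
      open ≤-Reasoning
      target-touches : ∀ k → ∃ (Hit k) → Touches u v (piece k)
      target-touches k (i , (dᵢ , _) , t∈) = member-touches u v (piece k) t∈ (away-between dᵢ (agree? x u i))

    alive-target : ∃ λ i → Separating i × Alive (target i)
    alive-target =
      let i , sᵢ , light = pigeonhole₁ separating? few-hits
      in  i , sᵢ , alive-if-unhit λ k t∈ →
            light⇒unhit light k (≤-reflexive (sym (𝟙-yes (contains-target? k) (i , sᵢ , t∈)))) (sᵢ , t∈)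

    shrink : ∀ u′ v′ → Between u′ v′ ⊆ Between u v → ¬ Touches u′ v′ p →
             # (edgeWithin? u′ v′) ≤ d × # (touches? u′ v′) ≤ 1 + d
    shrink u′ v′ I′⊆I p-outside = fewer-within within-bound , ≤-pred (<-≤-trans fewer-touching touch-bound)
      where
      fewer-touching : # (touches? u′ v′) < # (touches? u v)
      fewer-touching = count-mono-< (touches? u′ v′ ∘ piece) (touches? u v ∘ piece)
                         (λ k → touches-mono u v u′ v′ I′⊆I (piece k)) kₚ p-touches p-outside
      fewer-within : # (edgeWithin? u v) ≤ d ⊎ EdgeWithin u v p × # (edgeWithin? u v) ≤ 1 + d →
                     # (edgeWithin? u′ v′) ≤ d
      fewer-within (inj₁ ≤d) =
        ≤-trans (count-mono (edgeWithin? u′ v′ ∘ piece) (edgeWithin? u v ∘ piece)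
                  (λ k → edgeWithin-mono u v u′ v′ I′⊆I (piece k))) ≤d
      fewer-within (inj₂ (p-within , ≤1+d)) =
        ≤-pred (<-≤-trans (count-mono-< (edgeWithin? u′ v′ ∘ piece) (edgeWithin? u v ∘ piece)
                             (λ k → edgeWithin-mono u v u′ v′ I′⊆I (piece k)) kₚ p-within
                             (p-outside ∘ edgeWithin⇒touches u′ v′ p)) ≤1+d)

    GeodesicsBelow : Set
    GeodesicsBelow = ∀ u′ v′ → hamming u′ v′ ≡ 2 + d → Alive u′ → Alive v′ →
      # (edgeWithin? u′ v′) ≤ d → # (touches? u′ v′) ≤ 1 + d → Walk subVerts F u′ v′ (2 + d)

    walk : GeodesicsBelow → Alive u → Alive v → Walk subVerts F u v (3 + d)
    walk IH alive-u alive-v = let i , (dᵢ , fᵢ) , alive-t = alive-target in finish dᵢ fᵢ (agree? x u i) alive-t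
      where
      finish : ∀ {i} → Differ u v i → Fixes p i → (a : Dec (Agree x u i)) → Alive (away i a) →
               Walk subVerts F u v (3 + d)
      finish {i} dᵢ fᵢ (yes x≡u) alive-uⁱ =
        let within′ , touch′ = shrink (flip u i) v (between-flip⊆ u v dᵢ) outside
        in  step alive-u (adj-flip u i)
              (IH (flip u i) v (flip-closer u v dᵢ h) alive-uⁱ alive-v within′ touch′)
        where
        outside : ¬ Touches (flip u i) v p
        outside t = let y , y∈p , y∈I′ = find t in
          dᵢ (trans (sym x≡u) (trans (fixes-coord p fᵢ x∈p y∈p) (between-flip⇒agree u v y dᵢ y∈I′)))
      finish {i} dᵢ fᵢ (no x≢u) alive-vⁱ =
        let within′ , touch′ = shrink u (flip v i) (between-flip-right⊆ u v dᵢ) outside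
        in  snoc (IH u (flip v i) (flip-closer-right u v dᵢ h) alive-u alive-vⁱ within′ touch′)
                 (adj-sym {x = v} (adj-flip v i)) alive-v
        where
        outside : ¬ Touches u (flip v i) p
        outside t = let y , y∈p , y∈I′ = find t in
          x≢u (trans (fixes-coord p fᵢ x∈p y∈p) (between-flip-right⇒agree u v y dᵢ y∈I′))

  geodesic : ∀ d {u v} → hamming u v ≡ 2 + d → Alive u → Alive v →
             # (edgeWithin? u v) ≤ d → # (touches? u v) ≤ 1 + d → Walk subVerts F u v (2 + d)
  geodesic zero {u} {v} h alive-u alive-v _ touch≤1 =
    let i , dᵢ , alive-uⁱ = step-towards u v (subst (# (touches? u v) <_) (sym h) (s≤s touch≤1))
    in  step alive-u (adj-flip u i) (step alive-uⁱ (flip-closer u v dᵢ h) (here alive-v))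
  geodesic (suc d) {u} {v} h alive-u alive-v within≤ touch≤
    with # (touches? u v) ≤? 1 + d | # (edgeWithin? u v) ≤? d
  ... | yes touch≤′ | yes within≤′ =
    let i , dᵢ , alive-uⁱ = step-towards u v (subst (# (touches? u v) <_) (sym h) (s≤s (m≤n⇒m≤1+n touch≤′)))
        I′⊆I = between-flip⊆ u v dᵢ
    in  step alive-u (adj-flip u i) (geodesic d (flip-closer u v dᵢ h) alive-uⁱ alive-v
          (≤-trans (count-mono _ _ λ k → edgeWithin-mono u v (flip u i) v I′⊆I (piece k)) within≤′)
          (≤-trans (count-mono _ _ λ k → touches-mono u v (flip u i) v I′⊆I (piece k)) touch≤′))
  ... | _ | no within≰ =
    let k , p-within = count-pos⇒∃ (edgeWithin? u v ∘ piece) (<-≤-trans (s≤s z≤n) (≰⇒> within≰))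
        x , x∈p , x∈I = find (edgeWithin⇒touches u v (piece k) p-within)
    in  Avoiding.walk d u v h k x x∈p x∈I (inj₂ (p-within , within≤)) touch≤ (λ u′ v′ → geodesic d {u′} {v′})
          alive-u alive-v
  ... | no touch≰ | yes within≤′ =
    let k , p-touches = count-pos⇒∃ (touches? u v ∘ piece) (<-≤-trans (s≤s z≤n) (≰⇒> touch≰))
        x , x∈p , x∈I = find p-touches
    in  Avoiding.walk d u v h k x x∈p x∈I (inj₁ within≤′) touch≤ (λ u′ v′ → geodesic d {u′} {v′})
          alive-u alive-v

  Blocked : Vertex n → Vertex n → Set
  Blocked u v = ∀ i → Differ u v i → Removed subVerts F (flip u i)

  module Guards (u v : Vertex n) (blocked : Blocked u v) where

    open Neighbours u v using (Hit; hit?; hits-once)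

    Guard : Fin (length F) → Set
    Guard k = ∃ (Hit k)

    guard? : Decidable Guard
    guard? k = Fin.any? (hit? k)

    many-guards : hamming u v ≤ count guard?
    many-guards = ≮⇒≥ λ few →
      let i , dᵢ , light = pigeonhole₁ (differ? u v) (subst (count guard? <_) (hamming≡count-differ u v) few)
          k , uⁱ∈        = dead⇒in-piece (blocked i dᵢ)
      in  light⇒unhit light k (≤-reflexive (sym (𝟙-yes (guard? k) (i , dᵢ , uⁱ∈)))) (dᵢ , uⁱ∈)
      where
      open Pigeonhole Hit hit? hits-once (𝟙 ∘ guard?)

  blocked⇒hamming≤length : ∀ {u v} → Blocked u v → hamming u v ≤ length F
  blocked⇒hamming≤length {u} {v} blocked = ≤-trans many-guards (count≤n guard?)
    where open Guards u v blocked

  module Detour (d : ℕ) (u v : Vertex n) (h : hamming u v ≡ 2 + d) (room : length F + 2 ≤ n)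
                (blocked : Blocked u v) where

    open Guards u v blocked

    -- A coordinate of load below 2 + d is then crossed by guards only.
    weight : ∀ {k} → Dec (Guard k) → ℕ
    weight (yes _) = 1
    weight (no _)  = 2 + d

    Crossing : Fin (length F) → Fin n → Set
    Crossing k j = Agree u v j × Touches (flip u j) (flip v j) (piece k)

    crossing? : ∀ k j → Dec (Crossing k j)
    crossing? k j = agree? u v j ×-dec touches? (flip u j) (flip v j) (piece k)

    crosses-once : ∀ k j j′ → Crossing k j → Crossing k j′ → j ≡ j′
    crosses-once k j j′ (aⱼ , tⱼ) (aⱼ′ , tⱼ′) =
      let x , x∈p , x∈Iⱼ  = find tⱼ
          y , y∈p , y∈Iⱼ′ = find tⱼ′
      in  one-per-piece (piece k) (λ j≢j′ → shifted-intervals-far u v j≢j′ aⱼ aⱼ′ x∈Iⱼ y∈Iⱼ′) x∈p y∈p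

    open Pigeonhole Crossing crossing? crosses-once (weight ∘ guard?)

    total-weight : ∑[ k < length F ] weight (guard? k) ≡ count guard? + (2 + d) * count (¬? ∘ guard?)
    total-weight = begin
      ∑[ k < length F ] weight (guard? k)                                 ≡⟨ sum-cong-≗ (split ∘ guard?) ⟩
      ∑[ k < length F ] (𝟙 (guard? k) + (2 + d) * 𝟙 (¬? (guard? k)))     ≡⟨ ∑-distrib-+ (𝟙 ∘ guard?) _ ⟩
      count guard? + ∑[ k < length F ] ((2 + d) * 𝟙 (¬? (guard? k)))
        ≡⟨ cong (count guard? +_) (*-distribˡ-sum (2 + d) (𝟙 ∘ ¬? ∘ guard?)) ⟨
      count guard? + (2 + d) * count (¬? ∘ guard?)                        ∎
      where
      open ≡-Reasoning
      split : ∀ {k} (g : Dec (Guard k)) → weight g ≡ 𝟙 g + (2 + d) * 𝟙 (¬? g)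
      split (yes _) = cong suc (sym (*-zeroʳ (2 + d)))
      split (no _)  = sym (*-identityʳ (2 + d))

    light-coordinate : ∃ λ j → Agree u v j × load j < 2 + d
    light-coordinate = pigeonhole (agree? u v) (2 + d) (subst (_< (2 + d) * count (agree? u v)) (sym total-weight)
      (detour-arithmetic (1 + d) (count guard?) (count (¬? ∘ guard?)) (count (agree? u v))
        (subst (_≤ count guard?) h many-guards) fits))
      where
      fits : count guard? + count (¬? ∘ guard?) + 2 ≤ 2 + d + count (agree? u v)
      fits = begin
        count guard? + count (¬? ∘ guard?) + 2   ≡⟨ cong (_+ 2) (count+count∁ guard?) ⟩
        length F + 2                             ≤⟨ room ⟩
        n                                        ≡⟨ count+count∁ (agree? u v) ⟨
        count (agree? u v) + count (differ? u v)
          ≡⟨ cong (count (agree? u v) +_) (trans (sym (hamming≡count-differ u v)) h) ⟩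
        count (agree? u v) + (2 + d)             ≡⟨ +-comm (count (agree? u v)) (2 + d) ⟩
        2 + d + count (agree? u v)               ∎
        where open ≤-Reasoning

    module Through (j : Fin n) (aⱼ : Agree u v j) (light : load j < 2 + d) where

      differ≢j : ∀ {i} → Differ u v i → i ≢ j
      differ≢j dᵢ refl = dᵢ aⱼ

      touching⇒guard : ∀ k → Touches (flip u j) (flip v j) (piece k) → Guard k
      touching⇒guard k t = decidable-stable (guard? k) λ ¬g →
        <⇒≱ light (subst (_≤ load j) (unguarded-weight (guard? k) ¬g) (w≤load (aⱼ , t)))
        where
        unguarded-weight : ∀ {k} (g : Dec (Guard k)) → ¬ Guard k → weight g ≡ 2 + d
        unguarded-weight (yes g) ¬g = contradiction g ¬g
        unguarded-weight (no _)  _  = refl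

      few-touching : # (touches? (flip u j) (flip v j)) ≤ 1 + d
      few-touching = ≤-pred (≤-<-trans (∑-mono-≤ λ k → bound (touches? _ _ (piece k)) (crossing? k j) (guard? k)) light)
        where
        bound : ∀ {k} (t : Dec (Touches (flip u j) (flip v j) (piece k))) (c : Dec (Crossing k j)) (g : Dec (Guard k)) →
                𝟙 t ≤ 𝟙 c * weight g
        bound (no _)  _        _       = z≤n
        bound (yes t) (no ¬c)  _       = contradiction (aⱼ , t) ¬c
        bound (yes _) (yes _)  (yes _) = ≤-refl
        bound (yes _) (yes _)  (no _)  = s≤s z≤n

      none-within : # (edgeWithin? (flip u j) (flip v j)) ≤ d
      none-within = subst (_≤ d) (sym (count-none (edgeWithin? _ _ ∘ piece) excluded)) z≤n
        where
        excluded : ∀ k → ¬ EdgeWithin (flip u j) (flip v j) (piece k)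
        excluded k within =
          let i , dᵢ , uⁱ∈ = touching⇒guard k (edgeWithin⇒touches _ _ (piece k) within)
          in  not-¬ (lookup-flip-other u (differ≢j dᵢ))
                    (shifted-coord u v aⱼ (edgeWithin-member _ _ (piece k) within uⁱ∈))

      alive-uʲ : Alive (flip u j)
      alive-uʲ = alive-if-unhit λ k uʲ∈ →
        let i , dᵢ , uⁱ∈ = touching⇒guard k (member-touches _ _ (piece k) uʲ∈ (between-left _ _))
        in  far⇒not-in-one-piece (piece k) (flips-far u (differ≢j dᵢ)) uⁱ∈ uʲ∈

      alive-vʲ : Alive (flip v j)
      alive-vʲ = alive-if-unhit λ k vʲ∈ →
        let i , dᵢ , uⁱ∈ = touching⇒guard k (member-touches _ _ (piece k) vʲ∈ (between-right _ _))
        in  far⇒not-in-one-piece (piece k) (far dᵢ) uⁱ∈ vʲ∈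
        where
        far : ∀ {i} → Differ u v i → 2 ≤ hamming (flip u i) (flip v j)
        far {i} dᵢ = begin
          2                             ≤⟨ s≤s (s≤s z≤n) ⟩
          2 + d                         ≡⟨ cong suc (flip-closer u v dᵢ h) ⟨
          suc (hamming (flip u i) v)
            ≡⟨ hamming-flip-agreeʳ (flip u i) v j (trans (lookup-flip-other u (differ≢j dᵢ)) aⱼ) ⟨
          hamming (flip u i) (flip v j) ∎
          where open ≤-Reasoning

      walk : Alive u → Alive v → Walk subVerts F u v (4 + d)
      walk alive-u alive-v =
        step alive-u (adj-flip u j)
          (snoc (geodesic d (trans (hamming-flip-both u v j) h) alive-uʲ alive-vʲ none-within few-touching)
                (adj-sym {x = v} (adj-flip v j)) alive-v)

    walk : Alive u → Alive v → Walk subVerts F u v (4 + d)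
    walk = let j , aⱼ , light = light-coordinate in Through.walk j aⱼ light

  removed? : ∀ x → Dec (Removed subVerts F x)
  removed? x = Any.any? (λ q → x ∈? subVerts q) F

  BlockedDetours : ℕ → Set
  BlockedDetours e = ∀ d u v → hamming u v ≡ 2 + d → Alive u → Alive v → Blocked u v →
                     Walk subVerts F u v (e + (2 + d))

  descend : ∀ e → BlockedDetours e →
            ∀ h u v → hamming u v ≡ h → Alive u → Alive v → ∃ λ l → l ≤ h + e × Walk subVerts F u v l
  descend e detour zero u v h alive-u alive-v =
    0 , z≤n , subst (λ v → Walk subVerts F u v 0) (hamming≡0⇒≡ u v h) (here alive-u)
  descend e detour (suc h′) u v h alive-u alive-v =
    towards (Fin.any? λ i → differ? u v i ×-dec ¬? (removed? (flip u i)))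
    where
    around : ∀ k → hamming u v ≡ suc k → Blocked u v → ∃ λ l → l ≤ suc k + e × Walk subVerts F u v l
    around zero    h _       = 1 , s≤s z≤n , step alive-u h (here alive-v)
    around (suc d) h blocked = e + (2 + d) , ≤-reflexive (+-comm e (2 + d)) , detour d u v h alive-u alive-v blocked
    towards : Dec (∃ λ i → Differ u v i × Alive (flip u i)) → ∃ λ l → l ≤ suc h′ + e × Walk subVerts F u v l
    towards (yes (i , dᵢ , alive-uⁱ)) = Product.map suc (Product.map s≤s (step alive-u (adj-flip u i)))
      (descend e detour h′ (flip u i) v (flip-closer u v dᵢ h) alive-uⁱ alive-v)
    towards (no none) = around h′ h λ i dᵢ → decidable-stable (removed? (flip u i)) λ alive → none (i , dᵢ , alive)

  diameter≤n+1 : length F + 2 ≤ n → DiamAtMost subVerts F (n + 1)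
  diameter≤n+1 room u v alive-u alive-v with hamming u v ≟ℕ n
  ... | no h≢n =
    let l , l≤ , walk = descend 2 detour (hamming u v) u v refl alive-u alive-v
    in  l , ≤-trans l≤ short , walk
    where
    short : hamming u v + 2 ≤ n + 1
    short = subst (_≤ n + 1) (sym (+-suc (hamming u v) 1)) (+-monoˡ-≤ 1 (≤∧≢⇒< (hamming≤n u v) h≢n))
    detour : BlockedDetours 2
    detour d u v h alive-u alive-v blocked = Detour.walk d u v h room blocked alive-u alive-v
  ... | yes h≡n with d , refl ← m≤n⇒∃[o]m+o≡n (≤-trans (m≤n+m 2 (length F)) room) =
    2 + d , m≤m+n (2 + d) 1 ,
    geodesic d h≡n alive-u alive-v (≤-trans (count≤n _) faults≤d) (≤-trans (count≤n _) (m≤n⇒m≤1+n faults≤d))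
    where
    faults≤d : length F ≤ d
    faults≤d = +-cancelʳ-≤ 2 (length F) d (subst (length F + 2 ≤_) (+-comm 2 d) room)

  diameter≤n : length F ≤ 1 → DiamAtMost subVerts F n
  diameter≤n few u v alive-u alive-v =
    let l , l≤ , walk = descend 0 unblocked (hamming u v) u v refl alive-u alive-v
    in  l , ≤-trans l≤ (≤-trans (≤-reflexive (+-identityʳ _)) (hamming≤n u v)) , walk
    where
    unblocked : BlockedDetours 0
    unblocked d u v h _ _ blocked =
      contradiction (≤-trans (subst (_≤ length F) h (blocked⇒hamming≤length blocked)) few) λ { (s≤s ()) }

-- Connectivity and fault diameter

module _ {n : ℕ} {S : Set} (vs : S → List (Vertex n)) where

  bounded-diameter⇒connected : ∀ {F d} → DiamAtMost vs F d → ¬ Disconnected vs F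
  bounded-diameter⇒connected diam (u , v , alive-u , alive-v , no-walk) =
    let l , _ , walk = diam u v alive-u alive-v in no-walk l walk

  module _ {κ d : ℕ} (cut : Σ (List S) λ F → length F ≡ κ × PairwiseDisjoint vs F × Disconnected vs F)
                     (bound : ∀ F → suc (length F) ≤ κ → DiamAtMost vs F d) where

    cut-size-minimal : ∀ F → Disconnected vs F → κ ≤ length F
    cut-size-minimal F disconnected = ≮⇒≥ λ small → bounded-diameter⇒connected (bound F small) disconnected

    is-connectivity : IsConnectivity vs κ
    is-connectivity = cut , λ F _ → cut-size-minimal F

    connectivity-unique : ∀ {k} → IsConnectivity vs k → κ ≡ k
    connectivity-unique ((F , refl , _ , disconnected) , minimal) =
      let F₀ , |F₀|≡κ , disjoint₀ , disconnected₀ = cut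
      in  ≤-antisym (cut-size-minimal F disconnected) (subst (_ ≤_) |F₀|≡κ (minimal F₀ disjoint₀ disconnected₀))

    fault-diameter : (Σ (List S) λ F → PairwiseDisjoint vs F × suc (length F) ≤ κ × DiamIs vs F d) →
                     FaultDiameterIs vs d
    fault-diameter extremal = (κ , is-connectivity) , λ k connectivity →
      subst (λ k → MaxFaultDiamIs vs k d) (connectivity-unique connectivity) ((λ F _ → bound F) , extremal)

module Transfer {n : ℕ} {S T : Set} {vs : S → List (Vertex n)} {vt : T → List (Vertex n)} {F : List S} {G : List T}
                (F⊆G : Removed vs F ⊆ Removed vt G) (G⊆F : Removed vt G ⊆ Removed vs F) where

  private
    survives⇒ : Survives vs F ⊆ Survives vt G
    survives⇒ alive = alive ∘ G⊆F

    survives⇐ : Survives vt G ⊆ Survives vs F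
    survives⇐ alive = alive ∘ F⊆G


  diamAtMost : ∀ {d} → DiamAtMost vs F d → DiamAtMost vt G d
  diamAtMost diam u v alive-u alive-v =
    let l , l≤d , walk = diam u v (survives⇐ alive-u) (survives⇐ alive-v) in l , l≤d , walk-map survives⇒ walk

  diamIs : ∀ {d} → DiamIs vs F d → DiamIs vt G d
  diamIs (diam , u , v , alive-u , alive-v , walk , shortest) =
    diamAtMost diam , u , v , survives⇒ alive-u , survives⇒ alive-v , walk-map survives⇒ walk ,
    λ l walk′ → shortest l (walk-map survives⇐ walk′)

  disconnected : Disconnected vs F → Disconnected vt G
  disconnected (u , v , alive-u , alive-v , no-walk) =
    u , v , survives⇒ alive-u , survives⇒ alive-v , λ l walk → no-walk l (walk-map survives⇐ walk)

toSub : ∀ {n} → Q1Str n → Q1Sub n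
toSub (edge u v u~v) = edge u v u~v

strVerts≡subVerts : ∀ {n} (s : Q1Str n) → strVerts s ≡ subVerts (toSub s)
strVerts≡subVerts (edge _ _ _) = refl

module FromSub {n : ℕ} (E : List (Q1Str n)) where

  str⊆sub : Removed strVerts E ⊆ Removed subVerts (List.map toSub E)
  str⊆sub = Anyₚ.map⁺ ∘ Any.map λ {s} → subst (_ ∈_) (strVerts≡subVerts s)

  sub⊆str : Removed subVerts (List.map toSub E) ⊆ Removed strVerts E
  sub⊆str = Any.map (λ {s} → subst (_ ∈_) (sym (strVerts≡subVerts s))) ∘ Anyₚ.map⁻

  open Transfer (sub⊆str) (str⊆sub) public

  disjoint : PairwiseDisjoint subVerts (List.map toSub E) → PairwiseDisjoint strVerts E
  disjoint = AllPairs.map (λ {s} {t} disjoint-st x x∈s x∈t →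
                 disjoint-st x (subst (_ ∈_) (strVerts≡subVerts s) x∈s) (subst (_ ∈_) (strVerts≡subVerts t) x∈t))
           ∘ AllPairsₚ.map⁻

-- Extremal families

zeros ones : ∀ m → Vertex m
zeros m = replicate m false
ones  m = replicate m true

hamming-zeros-ones : ∀ m → hamming (zeros m) (ones m) ≡ m
hamming-zeros-ones zero    = refl
hamming-zeros-ones (suc m) = cong suc (hamming-zeros-ones m)

neighbours : ∀ {m} → Vertex m → List (Vertex m)
neighbours x = List.tabulate (flip x)

∈-neighbours⁻ : ∀ {m} {x y : Vertex m} → y ∈ neighbours x → Adj x y
∈-neighbours⁻ {x = x} y∈ with i , refl ← ∈-tabulate⁻ y∈ = adj-flip x i

neighbours-unique : ∀ {m} (x : Vertex m) → Unique (neighbours x)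
neighbours-unique x = tabulate⁺ λ {i} {j} eq → decidable-stable (i Fin.≟ j) λ i≢j →
  contradiction (subst (2 ≤_) (trans (cong (hamming (flip x i)) (sym eq)) (hamming-self (flip x i))) (flips-far x i≢j)) λ ()

module Prisms {k : ℕ} (a b : Vertex k) (a~b : Adj a b) (m : ℕ) where

  prism : Vertex m → Q1Str (k + m)
  prism w = edge (a ++ w) (b ++ w) (trans (hamming-++ a b w w) (trans (cong (_+ hamming w w) a~b) (cong suc (hamming-self w))))

  edges : List (Q1Str (k + m))
  edges = List.map prism (neighbours (zeros m))

  faults : List (Q1Sub (k + m))
  faults = List.map toSub edges

  length-edges : length edges ≡ m
  length-edges = trans (length-map prism (neighbours (zeros m))) (length-tabulate (flip (zeros m)))

  length-faults : length faults ≡ m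
  length-faults = trans (length-map toSub edges) length-edges

  removed⇒ : ∀ x t → Removed subVerts faults (x ++ t) → t ∈ neighbours (zeros m)
  removed⇒ x t = Any.map layer ∘ Anyₚ.map⁻ ∘ Anyₚ.map⁻
    where
    layer : ∀ {w} → x ++ t ∈ (a ++ w) ∷ (b ++ w) ∷ [] → t ≡ w
    layer (here eq)         = ++-injectiveʳ x a eq
    layer (there (here eq)) = ++-injectiveʳ x b eq

  ⇒removed : ∀ {x t} → x ≡ a ⊎ x ≡ b → t ∈ neighbours (zeros m) → Removed subVerts faults (x ++ t)
  ⇒removed x∈ab = Anyₚ.map⁺ ∘ Anyₚ.map⁺ ∘ Any.map (layer x∈ab)
    where
    layer : ∀ {x t w} → x ≡ a ⊎ x ≡ b → t ≡ w → x ++ t ∈ (a ++ w) ∷ (b ++ w) ∷ []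
    layer (inj₁ refl) refl = here refl
    layer (inj₂ refl) refl = there (here refl)

  alive-zeros : ∀ x → Survives subVerts faults (x ++ zeros m)
  alive-zeros x = (λ h → 0≢1+n (trans (sym (hamming-self (zeros m))) h)) ∘ ∈-neighbours⁻ ∘ removed⇒ x (zeros m)

  alive-ones : 2 ≤ m → ∀ x → Survives subVerts faults (x ++ ones m)
  alive-ones 2≤m x =
    (λ h → <⇒≱ 2≤m (≤-reflexive (trans (sym (hamming-zeros-ones m)) h))) ∘ ∈-neighbours⁻ ∘ removed⇒ x (ones m)

  disjoint : PairwiseDisjoint subVerts faults
  disjoint = AllPairsₚ.map⁺ (AllPairsₚ.map⁺ (AllPairs.map (λ w≢w′ y y∈ y∈′ → w≢w′ (same-layer y∈ y∈′))
                                                           (neighbours-unique (zeros m))))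
    where
    same-layer : ∀ {y w w′} → y ∈ (a ++ w) ∷ (b ++ w) ∷ [] → y ∈ (a ++ w′) ∷ (b ++ w′) ∷ [] → w ≡ w′
    same-layer (here refl)         (here eq)         = ++-injectiveʳ a a eq
    same-layer (here refl)         (there (here eq)) = ++-injectiveʳ a b eq
    same-layer (there (here refl)) (here eq)         = ++-injectiveʳ b a eq
    same-layer (there (here refl)) (there (here eq)) = ++-injectiveʳ b b eq

module IsolatedEdge (m : ℕ) where

  open Prisms (false ∷ []) (true ∷ []) refl m public

  stays-on-axis : ∀ {c y l} → Walk subVerts faults (c ∷ zeros m) y l → ∃ λ c′ → y ≡ c′ ∷ zeros m
  stays-on-axis {c} (here _) = c , refl
  stays-on-axis {c} (step {v = x} _ c0~x walk) with adj⇒flip (c ∷ zeros m) x c0~x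
  ... | zero  , refl = stays-on-axis walk
  ... | suc j , refl = contradiction (⇒removed (bit c) (∈-tabulate⁺ j)) (walk-start walk)
    where
    bit : ∀ c → c ∷ [] ≡ false ∷ [] ⊎ c ∷ [] ≡ true ∷ []
    bit false = inj₁ refl
    bit true  = inj₂ refl

  disconnected : 2 ≤ m → Disconnected subVerts faults
  disconnected 2≤m =
    false ∷ zeros m , false ∷ ones m , alive-zeros (false ∷ []) , alive-ones 2≤m (false ∷ []) , λ l walk →
      let _ , on-axis = stays-on-axis walk in
      zeros≢ones (trans (cong (hamming (zeros m)) (sym (Vec.∷-injectiveʳ on-axis))) (hamming-zeros-ones m))
    where
    zeros≢ones : hamming (zeros m) (zeros m) ≢ m
    zeros≢ones h = contradiction (subst (2 ≤_) (trans (sym h) (hamming-self (zeros m))) 2≤m) λ ()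

module LongDetour (m : ℕ) where

  open Prisms (false ∷ false ∷ []) (false ∷ true ∷ []) refl m public

  u v : Vertex (2 + m)
  u = false ∷ false ∷ zeros m
  v = false ∷ true ∷ ones m

  off-axis : Vertex m → ℕ
  off-axis t with Vec.≡-dec _≟_ t (zeros m)
  ... | yes _ = 0
  ... | no _  = 2

  off-axis≤2 : ∀ t → off-axis t ≤ 2
  off-axis≤2 t with Vec.≡-dec _≟_ t (zeros m)
  ... | yes _ = z≤n
  ... | no _  = ≤-refl

  -- A walk leaves the axis 00·0ᵐ — 01·0ᵐ only through the half x₀ = 1, the rungs
  -- next to the axis being removed, and must return to x₀ = 0; bonus charges
  -- these two steps in advance.
  bonus : Vertex (2 + m) → ℕ
  bonus (true  ∷ _)     = 0
  bonus (false ∷ _ ∷ t) = off-axis t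

  φ : Vertex (2 + m) → ℕ
  φ x = hamming u x + bonus x

  bonus-flip-tail : ∀ x i → Survives subVerts faults (flip x (suc i)) → bonus (flip x (suc i)) ≤ bonus x
  bonus-flip-tail (true  ∷ _ ∷ _) _       _     = z≤n
  bonus-flip-tail (false ∷ c ∷ t) zero    _     = ≤-refl
  bonus-flip-tail (false ∷ c ∷ t) (suc j) alive with Vec.≡-dec _≟_ t (zeros m)
  ... | yes refl = contradiction (⇒removed (bit c) (∈-tabulate⁺ j)) alive
    where
    bit : ∀ c → false ∷ c ∷ [] ≡ false ∷ false ∷ [] ⊎ false ∷ c ∷ [] ≡ false ∷ true ∷ []
    bit false = inj₁ refl
    bit true  = inj₂ refl
  ... | no _     = off-axis≤2 (flip t j)

  φ-step : ∀ x y → Survives subVerts faults x → Survives subVerts faults y → Adj x y → φ y ≤ suc (φ x)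
  φ-step x y _ alive-y x~y with adj⇒flip x y x~y
  φ-step (true ∷ c ∷ t) _ _ _ _ | zero , refl = begin
    H + off-axis t  ≤⟨ +-monoʳ-≤ H (off-axis≤2 t) ⟩
    H + 2           ≡⟨ +-comm H 2 ⟩
    2 + H           ≡⟨ cong (2 +_) (+-identityʳ H) ⟨
    suc (suc H + 0) ∎
    where
    open ≤-Reasoning
    H = hamming (false ∷ zeros m) (c ∷ t)
  φ-step (false ∷ c ∷ t) _ _ _ _ | zero , refl =
    s≤s (≤-trans (≤-reflexive (+-identityʳ H)) (m≤m+n H (off-axis t)))
    where H = hamming (false ∷ zeros m) (c ∷ t)
  φ-step x _ _ alive-y _ | suc i , refl =
    ≤-trans (+-monoʳ-≤ _ (bonus-flip-tail x i alive-y)) (+-monoˡ-≤ (bonus x) (hamming-flip-≤ u x (suc i)))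

  off-axis-zeros : off-axis (zeros m) ≡ 0
  off-axis-zeros with Vec.≡-dec _≟_ (zeros m) (zeros m)
  ... | yes _      = refl
  ... | no ≢zeros  = contradiction refl ≢zeros

  φ-u : φ u ≡ 0
  φ-u = cong₂ _+_ (hamming-self (zeros m)) off-axis-zeros

  φ-v : 1 ≤ m → φ v ≡ (2 + m) + 1
  φ-v 1≤m with Vec.≡-dec _≟_ (ones m) (zeros m)
  ... | yes ones≡zeros = contradiction (subst (1 ≤_) m≡0 1≤m) λ ()
    where
    m≡0 : m ≡ 0
    m≡0 = trans (sym (hamming-zeros-ones m)) (trans (cong (hamming (zeros m)) ones≡zeros) (hamming-self (zeros m)))
  ... | no _           = trans (cong (λ h → suc h + 2) (hamming-zeros-ones m)) (cong suc (+-suc m 1))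

  longest : 1 ≤ m → ∀ l → Walk subVerts faults u v l → (2 + m) + 1 ≤ l
  longest 1≤m l walk = subst₂ _≤_ (φ-v 1≤m) (cong (_+ l) φ-u) (walk-lipschitz φ φ-step walk)

  diameter : 2 ≤ m → DiamIs subVerts faults ((2 + m) + 1)
  diameter 2≤m = diamIs-from-bounds (Faults.diameter≤n+1 faults room)
    (alive-zeros (false ∷ false ∷ [])) (alive-ones 2≤m (false ∷ true ∷ [])) (longest (≤-trans (s≤s z≤n) 2≤m))
    where
    room : length faults + 2 ≤ 2 + m
    room = ≤-reflexive (trans (cong (_+ 2) length-faults) (+-comm m 2))

fault-diameters-from-edges : ∀ {n κ d} (cut extremal : List (Q1Str n)) →
  length cut ≡ κ → PairwiseDisjoint subVerts (List.map toSub cut) → Disconnected subVerts (List.map toSub cut) →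
  (∀ F → suc (length F) ≤ κ → DiamAtMost subVerts F d) →
  PairwiseDisjoint subVerts (List.map toSub extremal) → suc (length extremal) ≤ κ →
  DiamIs subVerts (List.map toSub extremal) d →
  SubFaultDiamIs n d × StrFaultDiamIs n d
fault-diameters-from-edges {κ = κ} cut extremal |cut| cut-disjoint cut-disconnects bound extremal-disjoint small diameter =
  fault-diameter subVerts (List.map toSub cut , trans (length-map toSub cut) |cut| , cut-disjoint , cut-disconnects)
    bound (List.map toSub extremal , extremal-disjoint , small′ extremal small , diameter) ,
  fault-diameter strVerts (cut , |cut| , FromSub.disjoint cut cut-disjoint , FromSub.disconnected cut cut-disconnects)
    (λ F small → FromSub.diamAtMost F (bound (List.map toSub F) (small′ F small)))
    (extremal , FromSub.disjoint extremal extremal-disjoint , small , FromSub.diamIs extremal diameter)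
  where
  small′ : ∀ {n} (F : List (Q1Str n)) → suc (length F) ≤ κ → suc (length (List.map toSub F)) ≤ κ
  small′ F = subst (λ l → suc l ≤ κ) (sym (length-map toSub F))

Q₃-fault-diameters : SubFaultDiamIs 3 3 × StrFaultDiamIs 3 3
Q₃-fault-diameters = fault-diameters-from-edges edges [] length-edges disjoint (disconnected ≤-refl)
  bound AllPairs.[] (s≤s z≤n)
  (diamIs-from-bounds {u = zeros 3} {v = ones 3} (bound [] (s≤s z≤n)) (λ ()) (λ ()) λ l → hamming≤length)
  where
  open IsolatedEdge 2
  bound : ∀ F → suc (length F) ≤ 2 → DiamAtMost subVerts F 3
  bound F small = Faults.diameter≤n F (≤-pred small)

Qₙ-fault-diameters : ∀ n → 4 ≤ n → SubFaultDiamIs n (n + 1) × StrFaultDiamIs n (n + 1)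
Qₙ-fault-diameters (suc (suc (suc (suc k)))) (s≤s (s≤s (s≤s (s≤s _)))) =
  fault-diameters-from-edges edges L.edges length-edges disjoint (disconnected (s≤s (s≤s z≤n)))
    bound L.disjoint (≤-reflexive (cong suc L.length-edges)) (L.diameter (s≤s (s≤s z≤n)))
  where
  open IsolatedEdge (3 + k)
  module L = LongDetour (2 + k)
  bound : ∀ F → suc (length F) ≤ 3 + k → DiamAtMost subVerts F (4 + k + 1)
  bound F small = Faults.diameter≤n+1 F (subst (_≤ 4 + k) (+-comm 2 (length F)) (s≤s small))

theorem3p6 : (SubFaultDiamIs 3 3 × StrFaultDiamIs 3 3)
    × (∀ (n : ℕ) → 4 ≤ n → SubFaultDiamIs n (n + 1) × StrFaultDiamIs n (n + 1))
theorem3p6 = Q₃-fault-diameters , Qₙ-fault-diameters
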